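{- Let $n = 2^m$ with $m \geq 2$, $N = n/2$, and let $H$ be the subgroup (under $\Delta$) of the power set of $\{1,\dots,N-1\}$ generated by $\{\{j, 2^{i-1}+j\} : j = 1, \dots, 2^{i-1}-1,\ i = 2, \dots, m-1\}$. For $i = 1, \dots, n/4$ let $M_i$ be the set of all edges of $Q_n$ of the forms $\big(A\Delta\langle 2i-2\rangle\Delta\overline{\langle N-r+2i-1\rangle}\Delta\theta(\langle r-1\rangle\Delta\langle 2i-2\rangle\Delta B),\ A\Delta\langle 2i-2\rangle\Delta\overline{\langle N-r+2i\rangle}\Delta\theta(\langle r-1\rangle\Delta\langle 2i-2\rangle\Delta B)\big)$ and $\big(A\Delta\langle 2i-2\rangle\Delta\langle N-r+2i-1\rangle\Delta\theta(\overline{\langle r-1\rangle}\Delta\langle 2i-2\rangle\Delta B),\ A\Delta\langle 2i-2\rangle\Delta\langle N-r+2i\rangle\Delta\theta(\overline{\langle r-1\rangle}\Delta\langle 2i-2\rangle\Delta B)\big)$, where $A, B \in H$ and $r \in \{2i-1, 2i, \dots, N+2i-2\}$. Then $M = M_1 \cup M_2 \cup \dots \cup M_{n/4}$ is a matching in $Q_n$ (its edges are pairwise vertex-disjoint).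
   Context: Vertices of $Q_n$ are subsets of $\{1,\dots,n\}$, adjacent iff their symmetric difference $\Delta$ has one element. With $N = n/2$: $\langle 0\rangle = \emptyset$; $\langle i\rangle = \{1, \dots, i\}$ for $1 \le i \le N$; $\langle N+i\rangle = \{i+1, \dots, N\}$ for $1 \le i \le N$. For $X \subseteq \{1,\dots,N\}$, $\overline{X} = \{1,\dots,N\}\setminus X$. $\theta(i) = i+N$ and $\theta(X) = \{\theta(x): x\in X\}$, $\theta(\emptyset)=\emptyset$. -}

module Defs where

open import Data.Bool using (Bool; true; false; if_then_else_; _xor_; _∨_)
open import Data.Nat using (ℕ; zero; suc; _+_; _*_; _∸_; _^_; _≤_; _≤ᵇ_; _<ᵇ_; _≡ᵇ_)
open import Data.Fin using (Fin; toℕ)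
open import Data.Fin.Subset using (Subset; ∁; ∣_∣)
open import Data.Vec using (Vec; tabulate; zipWith; replicate; _++_)
open import Data.Product using (_×_)
open import Data.Sum using (_⊎_)
open import Relation.Binary.PropositionalEquality using (_≡_)

-- Convention: a subset of {1,…,k} is a `Subset k` (= Vec Bool k);
-- the Fin-index x stands for the element (toℕ x + 1).

infixl 6 _Δ_
_Δ_ : ∀ {k} → Subset k → Subset k → Subset k
_Δ_ = zipWith _xor_

-- ⟨ k ⟩ ⊆ {1,…,N}:  ⟨0⟩ = ∅, ⟨k⟩ = {1..k} (k ≤ N), ⟨N+i⟩ = {i+1..N}
⟨_⟩ : ∀ {N} → ℕ → Subset N
⟨_⟩ {N} k = tabulate λ x →
  if k ≤ᵇ N then toℕ x <ᵇ k
            else (k ∸ N) ≤ᵇ toℕ x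

‾_ : ∀ {N} → Subset N → Subset N
‾_ = ∁

-- the subset {a, b} of {1,…,N} (a, b given as natural numbers ≥ 1)
pair : ∀ {N} → ℕ → ℕ → Subset N
pair a b = tabulate λ x → (suc (toℕ x) ≡ᵇ a) ∨ (suc (toℕ x) ≡ᵇ b)

ι : ∀ {N} → Subset N → Subset (N + N)
ι {N} X = X ++ replicate N false

θ : ∀ {N} → Subset N → Subset (N + N)
θ {N} X = replicate N false ++ X

data Gen (m : ℕ) {N : ℕ} : Subset N → Set where
  gen : ∀ i j → 2 ≤ i → i ≤ m ∸ 1 → 1 ≤ j → j ≤ 2 ^ (i ∸ 1) ∸ 1 →
        Gen m (pair j (2 ^ (i ∸ 1) + j))

-- H: subgroup of (P({1..N-1}), Δ) generated by the generators
-- (every element is its own inverse, so closure of ∅ under Δ-ing generators)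
data InH (m : ℕ) {N : ℕ} : Subset N → Set where
  h-zero : InH m (replicate N false)
  h-step : ∀ {X g} → InH m X → Gen m g → InH m (X Δ g)

Adjacent : ∀ {k} → Subset k → Subset k → Set
Adjacent u v = ∣ u Δ v ∣ ≡ 1

module _ (m : ℕ) where
  private
    N : ℕ
    N = 2 ^ (m ∸ 1)

  data InM : Subset (N + N) → Subset (N + N) → Set where
    form₁ : ∀ i r {A B : Subset N} → 1 ≤ i → i ≤ 2 ^ (m ∸ 2) →
            InH m A → InH m B → 2 * i ∸ 1 ≤ r → r ≤ N + 2 * i ∸ 2 →
            InM (ι (A Δ ⟨ 2 * i ∸ 2 ⟩ Δ ‾ ⟨ N + 2 * i ∸ 1 ∸ r ⟩)
                   Δ θ (⟨ r ∸ 1 ⟩ Δ ⟨ 2 * i ∸ 2 ⟩ Δ B))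
                (ι (A Δ ⟨ 2 * i ∸ 2 ⟩ Δ ‾ ⟨ N + 2 * i ∸ r ⟩)
                   Δ θ (⟨ r ∸ 1 ⟩ Δ ⟨ 2 * i ∸ 2 ⟩ Δ B))
    form₂ : ∀ i r {A B : Subset N} → 1 ≤ i → i ≤ 2 ^ (m ∸ 2) →
            InH m A → InH m B → 2 * i ∸ 1 ≤ r → r ≤ N + 2 * i ∸ 2 →
            InM (ι (A Δ ⟨ 2 * i ∸ 2 ⟩ Δ ⟨ N + 2 * i ∸ 1 ∸ r ⟩)
                   Δ θ (‾ ⟨ r ∸ 1 ⟩ Δ ⟨ 2 * i ∸ 2 ⟩ Δ B))
                (ι (A Δ ⟨ 2 * i ∸ 2 ⟩ Δ ⟨ N + 2 * i ∸ r ⟩)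
                   Δ θ (‾ ⟨ r ∸ 1 ⟩ Δ ⟨ 2 * i ∸ 2 ⟩ Δ B))

IsMatching : ∀ {k} → (Subset k → Subset k → Set) → Set
IsMatching {k} E =
  (∀ u v → E u v → Adjacent u v) ×
  (∀ u v u′ v′ → E u v → E u′ v′ →
     (u ≡ u′ ⊎ u ≡ v′ ⊎ v ≡ u′ ⊎ v ≡ v′) →
     (u ≡ u′ × v ≡ v′) ⊎ (u ≡ v′ × v ≡ u′))

{-# OPTIONS --safe #-}
module Submission where

-- For every a, let ψ a X be the parity of the number of multiples of 2^a in X ⊆ {1, …, N}.
-- Each ψ a is additive for Δ and vanishes on the generators {j, 2^k + j} of H (for j < 2^k,
-- 2^a divides j iff it divides 2^k + j), and ψ a ⟨j⟩ is the a-th binary digit of j: for j ≤ N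
-- it counts ⌊j/2^a⌋, and ⟨N + i⟩ is the complement of ⟨i⟩. Writing i = p + 1 and r = 2p + 1 + t,
-- the two halves of an endpoint of an edge therefore determine, digit by digit, the bitwise xor
-- of 2p, N − t + e and f·N, and of 2p + t, 2p and (1 − f)·N, where e ∈ {0, 1} tells the endpoint
-- and f the form of the edge. The parities give e; reading the other digits from the bottom up
-- while tracking the carries of 2p + t gives t and p, the top digit gives f, and cancellation
-- gives A and B. So distinct edges share no endpoint, and the two endpoints of an edge differ
-- exactly where ⟨N − t⟩ and ⟨N − t + 1⟩ do.

open import Defs
open import Data.Bool using (Bool; true; false; not; _∧_; _∨_; _xor_; if_then_else_)
import Data.Bool.Properties as 𝔹
open import Data.Bool.Solver using (module xor-∧-Solver)
open import Data.Empty using (⊥-elim)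
open import Data.Fin as Fin using (Fin; toℕ)
open import Data.Fin.Properties using (toℕ<n)
open import Data.Fin.Subset using (Subset; ∁; ∣_∣)
open import Data.Fin.Subset.Properties using (∣⊥∣≡0)
open import Data.Nat using (ℕ; zero; suc; _+_; _*_; _∸_; _^_; _≤_; _<_; z≤n; s≤s; ⌊_/2⌋; ⌈_/2⌉; _≤ᵇ_; _<ᵇ_; _≡ᵇ_)
import Data.Nat.Properties as ℕ
open import Data.Nat.Solver using (module +-*-Solver)
open import Data.Product using (Σ; _×_; _,_; proj₁; proj₂)
open import Data.Sum using (_⊎_; inj₁; inj₂)
open import Data.Vec using ([]; _∷_; tabulate; replicate; _++_)
import Data.Vec.Properties as Vec
open import Function using (_∘_; Equivalence)
open import Relation.Binary.PropositionalEquality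
open import Relation.Nullary using (yes; no)
open import Relation.Nullary.Reflects using (ofʸ)

xor-cancelˡ : ∀ u v → u xor (u xor v) ≡ v
xor-cancelˡ u v = trans (sym (𝔹.xor-assoc u u v)) (cong (_xor v) (𝔹.xor-same u))

xor-injectiveʳ : ∀ {u u′ v v′} → u ≡ u′ → u xor v ≡ u′ xor v′ → v ≡ v′
xor-injectiveʳ {u} {v = v} {v′} refl eq = trans (sym (xor-cancelˡ u v)) (trans (cong (u xor_) eq) (xor-cancelˡ u v′))

xor-injectiveˡ : ∀ {u u′ v v′} → u xor v ≡ u′ xor v′ → v ≡ v′ → u ≡ u′
xor-injectiveˡ {u} {u′} {v} eq refl = xor-injectiveʳ {v} refl (trans (𝔹.xor-comm v u) (trans eq (𝔹.xor-comm u′ v)))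

xor-interchange : ∀ a b c d → (a xor b) xor (c xor d) ≡ (a xor c) xor (b xor d)
xor-interchange = solve 4 (λ a b c d → (a :+ b) :+ (c :+ d) := (a :+ c) :+ (b :+ d)) refl
  where open xor-∧-Solver

-- Binary digits

boolToℕ : Bool → ℕ
boolToℕ false = 0
boolToℕ true  = 1

boolToℕ≤1 : ∀ b → boolToℕ b ≤ 1
boolToℕ≤1 false = z≤n
boolToℕ≤1 true  = s≤s z≤n

odd : ℕ → Bool
odd zero          = false
odd (suc zero)    = true
odd (suc (suc n)) = odd n

bit : ℕ → ℕ → Bool
bit zero    n = odd n
bit (suc a) n = bit a ⌊ n /2⌋

odd-suc : ∀ n → odd (suc n) ≡ not (odd n)
odd-suc zero          = refl
odd-suc (suc zero)    = refl
odd-suc (suc (suc n)) = odd-suc n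

odd-+ : ∀ m n → odd (m + n) ≡ odd m xor odd n
odd-+ zero          n = refl
odd-+ (suc zero)    n = odd-suc n
odd-+ (suc (suc m)) n = odd-+ m n

odd-2* : ∀ n → odd (2 * n) ≡ false
odd-2* n = begin
  odd (n + (n + 0))        ≡⟨ odd-+ n (n + 0) ⟩
  odd n xor odd (n + 0)    ≡⟨ cong (λ k → odd n xor odd k) (ℕ.+-identityʳ n) ⟩
  odd n xor odd n          ≡⟨ 𝔹.xor-same (odd n) ⟩
  false                    ∎
  where open ≡-Reasoning

odd-boolToℕ : ∀ b → odd (boolToℕ b) ≡ b
odd-boolToℕ false = refl
odd-boolToℕ true  = refl

⌊1+n/2⌋ : ∀ n → ⌊ suc n /2⌋ ≡ ⌊ n /2⌋ + boolToℕ (odd n)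
⌊1+n/2⌋ zero          = refl
⌊1+n/2⌋ (suc zero)    = refl
⌊1+n/2⌋ (suc (suc n)) = cong suc (⌊1+n/2⌋ n)

⌊m+n/2⌋ : ∀ m n → ⌊ m + n /2⌋ ≡ ⌊ m /2⌋ + ⌊ n /2⌋ + boolToℕ (odd m ∧ odd n)
⌊m+n/2⌋ zero          n = sym (ℕ.+-identityʳ ⌊ n /2⌋)
⌊m+n/2⌋ (suc zero)    n = ⌊1+n/2⌋ n
⌊m+n/2⌋ (suc (suc m)) n = cong suc (⌊m+n/2⌋ m n)

⌊2*n/2⌋ : ∀ n → ⌊ 2 * n /2⌋ ≡ n
⌊2*n/2⌋ n = sym (trans (ℕ.n≡⌊n+n/2⌋ n) (cong ⌊_/2⌋ (cong (n +_) (sym (ℕ.+-identityʳ n)))))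

⌊2*n+t/2⌋ : ∀ n t → ⌊ 2 * n + t /2⌋ ≡ n + ⌊ t /2⌋
⌊2*n+t/2⌋ n t = begin
  ⌊ 2 * n + t /2⌋                                        ≡⟨ ⌊m+n/2⌋ (2 * n) t ⟩
  ⌊ 2 * n /2⌋ + ⌊ t /2⌋ + boolToℕ (odd (2 * n) ∧ odd t)  ≡⟨ cong₂ (λ h o → h + ⌊ t /2⌋ + boolToℕ (o ∧ odd t))
                                                                   (⌊2*n/2⌋ n) (odd-2* n) ⟩
  n + ⌊ t /2⌋ + 0                                        ≡⟨ ℕ.+-identityʳ _ ⟩
  n + ⌊ t /2⌋                                            ∎
  where open ≡-Reasoning

⌊/2⌋-< : ∀ {t n} → t < 2 * n → ⌊ t /2⌋ < n
⌊/2⌋-< {t} {n} t<2n = ℕ.*-cancelˡ-< 2 ⌊ t /2⌋ n (ℕ.≤-<-trans 2⌊t/2⌋≤t t<2n)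
  where
  2⌊t/2⌋≤t : 2 * ⌊ t /2⌋ ≤ t
  2⌊t/2⌋≤t = begin
    ⌊ t /2⌋ + (⌊ t /2⌋ + 0) ≡⟨ cong (⌊ t /2⌋ +_) (ℕ.+-identityʳ ⌊ t /2⌋) ⟩
    ⌊ t /2⌋ + ⌊ t /2⌋       ≤⟨ ℕ.+-monoʳ-≤ ⌊ t /2⌋ (ℕ.⌊n/2⌋≤⌈n/2⌉ t) ⟩
    ⌊ t /2⌋ + ⌈ t /2⌉       ≡⟨ ℕ.⌊n/2⌋+⌈n/2⌉≡n t ⟩
    t                       ∎
    where open ℕ.≤-Reasoning

odd-⌊/2⌋-injective : ∀ {m n} → odd m ≡ odd n → ⌊ m /2⌋ ≡ ⌊ n /2⌋ → m ≡ n
odd-⌊/2⌋-injective {m} {n} odd≡ half≡ = begin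
  m                                     ≡⟨ split m ⟩
  ⌊ m /2⌋ + (⌊ m /2⌋ + boolToℕ (odd m)) ≡⟨ cong₂ (λ h o → h + (h + boolToℕ o)) half≡ odd≡ ⟩
  ⌊ n /2⌋ + (⌊ n /2⌋ + boolToℕ (odd n)) ≡⟨ split n ⟨
  n                                     ∎
  where
  open ≡-Reasoning
  split : ∀ k → k ≡ ⌊ k /2⌋ + (⌊ k /2⌋ + boolToℕ (odd k))
  split k = trans (sym (ℕ.⌊n/2⌋+⌈n/2⌉≡n k)) (cong (⌊ k /2⌋ +_) (⌊1+n/2⌋ k))

bit-0 : ∀ a → bit a 0 ≡ false
bit-0 zero    = refl
bit-0 (suc a) = bit-0 a

bit-2^+ : ∀ k a {t} → t < 2 ^ k → bit a (2 ^ k + t) ≡ bit a (2 ^ k) xor bit a t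
bit-2^+ zero    a       {zero}  _ = sym (trans (cong (bit a 1 xor_) (bit-0 a)) (𝔹.xor-identityʳ _))
bit-2^+ zero    a       {suc _} (s≤s ())
bit-2^+ (suc k) zero    {t}     _ = odd-+ (2 ^ suc k) t
bit-2^+ (suc k) (suc a) {t}     t<2^k+1 = begin
  bit a ⌊ 2 * 2 ^ k + t /2⌋              ≡⟨ cong (bit a) (⌊2*n+t/2⌋ (2 ^ k) t) ⟩
  bit a (2 ^ k + ⌊ t /2⌋)                ≡⟨ bit-2^+ k a (⌊/2⌋-< t<2^k+1) ⟩
  bit a (2 ^ k) xor bit a ⌊ t /2⌋        ≡⟨ cong (λ h → bit a h xor bit a ⌊ t /2⌋) (⌊2*n/2⌋ (2 ^ k)) ⟨
  bit a ⌊ 2 * 2 ^ k /2⌋ xor bit a ⌊ t /2⌋ ∎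
  where open ≡-Reasoning

bit-2^-self : ∀ k → bit k (2 ^ k) ≡ true
bit-2^-self zero    = refl
bit-2^-self (suc k) = trans (cong (bit k) (⌊2*n/2⌋ (2 ^ k))) (bit-2^-self k)

bit-2^-below : ∀ {a k} → a < k → bit a (2 ^ k) ≡ false
bit-2^-below {zero}  {suc k} _         = odd-2* (2 ^ k)
bit-2^-below {suc a} {suc k} (s≤s a<k) = trans (cong (bit a) (⌊2*n/2⌋ (2 ^ k))) (bit-2^-below a<k)

AgreeBelow : ℕ → ℕ → ℕ → Set
AgreeBelow j x y = ∀ {a} → a < j → bit a x ≡ bit a y

agreeBelow-suc : ∀ {j x y} → AgreeBelow j x y → bit j x ≡ bit j y → AgreeBelow (suc j) x y
agreeBelow-suc x≈y bitʲ a<1+j with ℕ.m<1+n⇒m<n∨m≡n a<1+j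
... | inj₁ a<j  = x≈y a<j
... | inj₂ refl = bitʲ

agreeBelow⇒≡ : ∀ j {x y} → x < 2 ^ j → y < 2 ^ j → AgreeBelow j x y → x ≡ y
agreeBelow⇒≡ zero    (s≤s z≤n) (s≤s z≤n) _ = refl
agreeBelow⇒≡ (suc j) x<2^j+1 y<2^j+1 x≈y =
  odd-⌊/2⌋-injective (x≈y (s≤s z≤n))
    (agreeBelow⇒≡ j (⌊/2⌋-< x<2^j+1) (⌊/2⌋-< y<2^j+1) (λ a<j → x≈y (s≤s a<j)))

carryOut : ℕ → Bool → Bool → ℕ
carryOut k p q = ⌊ k /2⌋ + boolToℕ (odd k ∧ p) + boolToℕ ((odd k xor p) ∧ q)

⌊k+x+y/2⌋ : ∀ k x y → ⌊ k + x + y /2⌋ ≡ carryOut k (odd x) (odd y) + ⌊ x /2⌋ + ⌊ y /2⌋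
⌊k+x+y/2⌋ k x y = begin
  ⌊ k + x + y /2⌋
    ≡⟨ ⌊m+n/2⌋ (k + x) y ⟩
  ⌊ k + x /2⌋ + ⌊ y /2⌋ + boolToℕ (odd (k + x) ∧ odd y)
    ≡⟨ cong₂ (λ h o → h + ⌊ y /2⌋ + boolToℕ (o ∧ odd y)) (⌊m+n/2⌋ k x) (odd-+ k x) ⟩
  ⌊ k /2⌋ + ⌊ x /2⌋ + boolToℕ (odd k ∧ odd x) + ⌊ y /2⌋ + boolToℕ ((odd k xor odd x) ∧ odd y)
    ≡⟨ solve 5 (λ h hx c hy c′ → h :+ hx :+ c :+ hy :+ c′ := h :+ c :+ c′ :+ hx :+ hy) refl
         ⌊ k /2⌋ ⌊ x /2⌋ (boolToℕ (odd k ∧ odd x)) ⌊ y /2⌋ (boolToℕ ((odd k xor odd x) ∧ odd y)) ⟩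
  carryOut k (odd x) (odd y) + ⌊ x /2⌋ + ⌊ y /2⌋
    ∎
  where open ≡-Reasoning; open +-*-Solver

carry₀ : ∀ k x y → odd (k + x + y) xor odd x xor odd y ≡ odd k
carry₀ k x y = begin
  odd (k + x + y) xor odd x xor odd y
    ≡⟨ cong (_xor odd x xor odd y) (trans (odd-+ (k + x) y) (cong (_xor odd y) (odd-+ k x))) ⟩
  ((odd k xor odd x) xor odd y) xor odd x xor odd y
    ≡⟨ solve 3 (λ a b c → ((a :+ b) :+ c) :+ (b :+ c) := a) refl (odd k) (odd x) (odd y) ⟩
  odd k
    ∎
  where open ≡-Reasoning; open xor-∧-Solver

-- The left-hand side is the carry into digit j of k + x + y.
carry-agree : ∀ j k {x y x′ y′} → AgreeBelow j x x′ → AgreeBelow j y y′ →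
              bit j (k + x + y) xor bit j x xor bit j y ≡ bit j (k + x′ + y′) xor bit j x′ xor bit j y′
carry-agree zero    k {x} {y} {x′} {y′} _ _ = trans (carry₀ k x y) (sym (carry₀ k x′ y′))
carry-agree (suc j) k {x} {y} {x′} {y′} x≈x′ y≈y′ = begin
  bit j ⌊ k + x + y /2⌋ xor bit j ⌊ x /2⌋ xor bit j ⌊ y /2⌋
    ≡⟨ cong (λ s → bit j s xor _) (⌊k+x+y/2⌋ k x y) ⟩
  bit j (carryOut k (odd x) (odd y) + ⌊ x /2⌋ + ⌊ y /2⌋) xor bit j ⌊ x /2⌋ xor bit j ⌊ y /2⌋
    ≡⟨ carry-agree j (carryOut k (odd x) (odd y)) (λ a<j → x≈x′ (s≤s a<j)) (λ a<j → y≈y′ (s≤s a<j)) ⟩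
  bit j (carryOut k (odd x) (odd y) + ⌊ x′ /2⌋ + ⌊ y′ /2⌋) xor bit j ⌊ x′ /2⌋ xor bit j ⌊ y′ /2⌋
    ≡⟨ cong₂ (λ p q → bit j (carryOut k p q + ⌊ x′ /2⌋ + ⌊ y′ /2⌋) xor _) (x≈x′ (s≤s z≤n)) (y≈y′ (s≤s z≤n)) ⟩
  bit j (carryOut k (odd x′) (odd y′) + ⌊ x′ /2⌋ + ⌊ y′ /2⌋) xor bit j ⌊ x′ /2⌋ xor bit j ⌊ y′ /2⌋
    ≡⟨ cong (λ s → bit j s xor _) (⌊k+x+y/2⌋ k x′ y′) ⟨
  bit j ⌊ k + x′ + y′ /2⌋ xor bit j ⌊ x′ /2⌋ xor bit j ⌊ y′ /2⌋
    ∎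
  where open ≡-Reasoning

+-cancelʳ-agreeBelow : ∀ j {x y x′ y′} → x + y ≡ x′ + y′ → AgreeBelow j y y′ → AgreeBelow j x x′
+-cancelʳ-agreeBelow zero    _    _    ()
+-cancelʳ-agreeBelow (suc j) {x} {y} {x′} {y′} x+y≡ y≈y′ = agreeBelow-suc x≈x′
  (xor-injectiveˡ (xor-injectiveʳ (cong (bit j) x+y≡) (carry-agree j 0 x≈x′ y≈y′ⱼ)) (y≈y′ (ℕ.n<1+n j)))
  where
  y≈y′ⱼ : AgreeBelow j y y′
  y≈y′ⱼ a<j = y≈y′ (ℕ.m<n⇒m<1+n a<j)
  x≈x′ : AgreeBelow j x x′
  x≈x′ = +-cancelʳ-agreeBelow j x+y≡ y≈y′ⱼ

-- The carry into digit j is known from the digits below j, so the second equation yields digit j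
-- of t, then z + t yields digit j of z, and the first equation yields digit j of c.
digits-agree : ∀ j {c t z c′ t′ z′} → z + t ≡ z′ + t′ →
               (∀ {a} → a < j → bit a c xor bit a z ≡ bit a c′ xor bit a z′) →
               (∀ {a} → a < j → bit a (c + t) xor bit a c ≡ bit a (c′ + t′) xor bit a c′) →
               AgreeBelow j c c′ × AgreeBelow j t t′
digits-agree zero _ _ _ = (λ ()) , (λ ())
digits-agree (suc j) {c} {t} {z} {c′} {t′} {z′} z+t≡ c⊕z≡ c+t⊕c≡ = agreeBelow-suc c≈c′ cⱼ≡ , t≈t′
  where
  below : AgreeBelow j c c′ × AgreeBelow j t t′
  below = digits-agree j z+t≡ (λ a<j → c⊕z≡ (ℕ.m<n⇒m<1+n a<j)) (λ a<j → c+t⊕c≡ (ℕ.m<n⇒m<1+n a<j))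
  c≈c′ : AgreeBelow j c c′
  c≈c′ = proj₁ below
  t≈t′ : AgreeBelow (suc j) t t′
  t≈t′ = agreeBelow-suc (proj₂ below)
    (xor-injectiveʳ (c+t⊕c≡ (ℕ.n<1+n j))
      (trans (𝔹.xor-assoc (bit j (c + t)) (bit j c) (bit j t))
        (trans (carry-agree j 0 c≈c′ (proj₂ below)) (sym (𝔹.xor-assoc (bit j (c′ + t′)) (bit j c′) (bit j t′))))))
  cⱼ≡ : bit j c ≡ bit j c′
  cⱼ≡ = xor-injectiveˡ (c⊕z≡ (ℕ.n<1+n j)) (+-cancelʳ-agreeBelow (suc j) z+t≡ t≈t′ (ℕ.n<1+n j))

module Decoding (K : ℕ) where

  N : ℕ
  N = 2 ^ suc K

  ∸+-cancel : ∀ {t} e → t ≤ N → N ∸ t + boolToℕ e + t ≡ N + boolToℕ e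
  ∸+-cancel {t} e t≤N = begin
    N ∸ t + boolToℕ e + t   ≡⟨ ℕ.+-assoc (N ∸ t) (boolToℕ e) t ⟩
    N ∸ t + (boolToℕ e + t) ≡⟨ cong (N ∸ t +_) (ℕ.+-comm (boolToℕ e) t) ⟩
    N ∸ t + (t + boolToℕ e) ≡⟨ ℕ.+-assoc (N ∸ t) t (boolToℕ e) ⟨
    N ∸ t + t + boolToℕ e   ≡⟨ cong (_+ boolToℕ e) (ℕ.m∸n+n≡m t≤N) ⟩
    N + boolToℕ e           ∎
    where open ≡-Reasoning

  odd-N+ : ∀ e → odd (N + boolToℕ e) ≡ e
  odd-N+ e = trans (odd-+ N (boolToℕ e)) (cong₂ _xor_ (odd-2* (2 ^ K)) (odd-boolToℕ e))

  module _ {c c′ t t′ : ℕ} {e e′ f f′ : Bool}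
           (c-even : odd c ≡ false) (c′-even : odd c′ ≡ false)
           (c<N : c < N) (c′<N : c′ < N) (t<N : t < N) (t′<N : t′ < N)
           (left≡ : ∀ a → bit a c xor bit a (N ∸ t + boolToℕ e) xor (f ∧ bit a N) ≡
                          bit a c′ xor bit a (N ∸ t′ + boolToℕ e′) xor (f′ ∧ bit a N))
           (right≡ : ∀ a → (bit a (c + t) xor (not f ∧ bit a N)) xor bit a c ≡
                           (bit a (c′ + t′) xor (not f′ ∧ bit a N)) xor bit a c′)
    where

    private
      z z′ : ℕ
      z = N ∸ t + boolToℕ e
      z′ = N ∸ t′ + boolToℕ e′

    low-left : ∀ {a} → a < suc K → bit a c xor bit a z ≡ bit a c′ xor bit a z′
    low-left {a} a<1+K with left≡ a
    ... | eq rewrite bit-2^-below a<1+K | 𝔹.∧-zeroʳ f | 𝔹.∧-zeroʳ f′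
                   | 𝔹.xor-identityʳ (bit a z) | 𝔹.xor-identityʳ (bit a z′) = eq

    low-right : ∀ {a} → a < suc K → bit a (c + t) xor bit a c ≡ bit a (c′ + t′) xor bit a c′
    low-right {a} a<1+K with right≡ a
    ... | eq rewrite bit-2^-below a<1+K | 𝔹.∧-zeroʳ (not f) | 𝔹.∧-zeroʳ (not f′)
                   | 𝔹.xor-identityʳ (bit a (c + t)) | 𝔹.xor-identityʳ (bit a (c′ + t′)) = eq

    odd-z≡ : odd z ≡ odd z′
    odd-z≡ with low-left {0} (s≤s z≤n)
    ... | eq rewrite c-even | c′-even = eq

    odd-t≡ : odd t ≡ odd t′
    odd-t≡ with low-right {0} (s≤s z≤n)
    ... | eq rewrite odd-+ c t | odd-+ c′ t′ | c-even | c′-even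
                   | 𝔹.xor-identityʳ (odd t) | 𝔹.xor-identityʳ (odd t′) = eq

    e≡e′ : e ≡ e′
    e≡e′ = begin
      e                    ≡⟨ odd-N+ e ⟨
      odd (N + boolToℕ e)  ≡⟨ cong odd (∸+-cancel e (ℕ.<⇒≤ t<N)) ⟨
      odd (z + t)          ≡⟨ odd-+ z t ⟩
      odd z xor odd t      ≡⟨ cong₂ _xor_ odd-z≡ odd-t≡ ⟩
      odd z′ xor odd t′    ≡⟨ odd-+ z′ t′ ⟨
      odd (z′ + t′)        ≡⟨ cong odd (∸+-cancel e′ (ℕ.<⇒≤ t′<N)) ⟩
      odd (N + boolToℕ e′) ≡⟨ odd-N+ e′ ⟩
      e′                   ∎
      where open ≡-Reasoning

    z+t≡ : z + t ≡ z′ + t′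
    z+t≡ = trans (∸+-cancel e (ℕ.<⇒≤ t<N))
                 (trans (cong (λ e → N + boolToℕ e) e≡e′) (sym (∸+-cancel e′ (ℕ.<⇒≤ t′<N))))

    c≡c′ : c ≡ c′
    c≡c′ = agreeBelow⇒≡ (suc K) c<N c′<N (proj₁ (digits-agree (suc K) z+t≡ low-left low-right))

    t≡t′ : t ≡ t′
    t≡t′ = agreeBelow⇒≡ (suc K) t<N t′<N (proj₂ (digits-agree (suc K) z+t≡ low-left low-right))

    f≡f′ : f ≡ f′
    f≡f′ = 𝔹.not-injective (begin
      not f                  ≡⟨ 𝔹.∧-identityʳ (not f) ⟨
      not f ∧ true           ≡⟨ cong (not f ∧_) (bit-2^-self (suc K)) ⟨
      not f ∧ bit (suc K) N  ≡⟨ xor-injectiveʳ {s} refl (xor-injectiveˡ {v = bit (suc K) c} top-digit refl) ⟩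
      not f′ ∧ bit (suc K) N ≡⟨ cong (not f′ ∧_) (bit-2^-self (suc K)) ⟩
      not f′ ∧ true          ≡⟨ 𝔹.∧-identityʳ (not f′) ⟩
      not f′                 ∎)
      where
      open ≡-Reasoning
      s : Bool
      s = bit (suc K) (c + t)
      top-digit : (s xor (not f ∧ bit (suc K) N)) xor bit (suc K) c ≡
                  (s xor (not f′ ∧ bit (suc K) N)) xor bit (suc K) c
      top-digit = subst₂ (λ c″ t″ → (s xor (not f ∧ bit (suc K) N)) xor bit (suc K) c ≡
                                    (bit (suc K) (c″ + t″) xor (not f′ ∧ bit (suc K) N)) xor bit (suc K) c″)
                         (sym c≡c′) (sym t≡t′) (right≡ (suc K))

    decode : c ≡ c′ × t ≡ t′ × e ≡ e′ × f ≡ f′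
    decode = c≡c′ , t≡t′ , e≡e′ , f≡f′

-- The parities ψ

xorSum : ℕ → (ℕ → Bool) → Bool
xorSum zero    g = false
xorSum (suc n) g = g 0 xor xorSum n (g ∘ suc)

xorSum-cong : ∀ n {g h : ℕ → Bool} → (∀ y → g y ≡ h y) → xorSum n g ≡ xorSum n h
xorSum-cong zero    g≗h = refl
xorSum-cong (suc n) g≗h = cong₂ _xor_ (g≗h 0) (xorSum-cong n (g≗h ∘ suc))

xorSum-false : ∀ n → xorSum n (λ _ → false) ≡ false
xorSum-false zero    = refl
xorSum-false (suc n) = xorSum-false n

xorSum-xor : ∀ n (g h : ℕ → Bool) → xorSum n (λ y → g y xor h y) ≡ xorSum n g xor xorSum n h
xorSum-xor zero    g h = refl
xorSum-xor (suc n) g h = trans (cong ((g 0 xor h 0) xor_) (xorSum-xor n (g ∘ suc) (h ∘ suc)))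
                               (xor-interchange (g 0) (h 0) (xorSum n (g ∘ suc)) (xorSum n (h ∘ suc)))

xorSum-telescope : ∀ n (h : ℕ → Bool) → xorSum n (λ y → h (suc y) xor h y) ≡ h n xor h 0
xorSum-telescope zero    h = sym (𝔹.xor-same (h 0))
xorSum-telescope (suc n) h = trans (cong ((h 1 xor h 0) xor_) (xorSum-telescope n (h ∘ suc)))
                                   (cancel (h 1) (h 0) (h (suc n)))
  where
  cancel : ∀ a b c → (a xor b) xor (c xor a) ≡ c xor b
  cancel = solve 3 (λ a b c → (a :+ b) :+ (c :+ a) := c :+ b) refl
    where open xor-∧-Solver

xorSum-below : ∀ {j n} (g : ℕ → Bool) → j ≤ n → xorSum n (λ y → (y <ᵇ j) ∧ g y) ≡ xorSum j g
xorSum-below {zero}  {n}     g _         = xorSum-false n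
xorSum-below {suc j} {suc n} g (s≤s j≤n) = cong (g 0 xor_) (xorSum-below (g ∘ suc) j≤n)

xorSum-point : ∀ {k n} (g : ℕ → Bool) → k < n → xorSum n (λ y → (y ≡ᵇ k) ∧ g y) ≡ g k
xorSum-point {zero}  {suc n} g _         = trans (cong (g 0 xor_) (xorSum-false n)) (𝔹.xor-identityʳ (g 0))
xorSum-point {suc k} {suc n} g (s≤s k<n) = xorSum-point (g ∘ suc) k<n

inner : ∀ {n} → (ℕ → Bool) → Subset n → Bool
inner w []      = false
inner w (x ∷ X) = (x ∧ w 0) xor inner (w ∘ suc) X

inner-⊥ : ∀ n (w : ℕ → Bool) → inner w (replicate n false) ≡ false
inner-⊥ zero    w = refl
inner-⊥ (suc n) w = inner-⊥ n (w ∘ suc)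

inner-Δ : ∀ {n} w (X Y : Subset n) → inner w (X Δ Y) ≡ inner w X xor inner w Y
inner-Δ w []      []      = refl
inner-Δ w (x ∷ X) (y ∷ Y) = begin
  (x xor y) ∧ w 0 xor inner (w ∘ suc) (X Δ Y)
    ≡⟨ cong₂ _xor_ (𝔹.∧-distribʳ-xor (w 0) x y) (inner-Δ (w ∘ suc) X Y) ⟩
  ((x ∧ w 0) xor (y ∧ w 0)) xor (inner (w ∘ suc) X xor inner (w ∘ suc) Y)
    ≡⟨ xor-interchange (x ∧ w 0) (y ∧ w 0) (inner (w ∘ suc) X) (inner (w ∘ suc) Y) ⟩
  (x ∧ w 0 xor inner (w ∘ suc) X) xor (y ∧ w 0 xor inner (w ∘ suc) Y)
    ∎
  where open ≡-Reasoning

inner-∁ : ∀ {n} w (X : Subset n) → inner w (∁ X) ≡ inner w X xor xorSum n w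
inner-∁ w []      = refl
inner-∁ {suc n} w (x ∷ X) = begin
  not x ∧ w 0 xor inner (w ∘ suc) (∁ X)
    ≡⟨ cong₂ _xor_ (trans (cong (_∧ w 0) (sym (𝔹.true-xor x))) (𝔹.∧-distribʳ-xor (w 0) true x))
                   (inner-∁ (w ∘ suc) X) ⟩
  (w 0 xor x ∧ w 0) xor (inner (w ∘ suc) X xor xorSum n (w ∘ suc))
    ≡⟨ rearrange (w 0) (x ∧ w 0) (inner (w ∘ suc) X) (xorSum n (w ∘ suc)) ⟩
  (x ∧ w 0 xor inner (w ∘ suc) X) xor (w 0 xor xorSum n (w ∘ suc))
    ∎
  where
  open ≡-Reasoning
  rearrange : ∀ a b c d → (a xor b) xor (c xor d) ≡ (b xor c) xor (a xor d)
  rearrange = solve 4 (λ a b c d → (a :+ b) :+ (c :+ d) := (b :+ c) :+ (a :+ d)) refl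
    where open xor-∧-Solver

inner-tabulate : ∀ {n} (w g : ℕ → Bool) → inner w (tabulate {n} (g ∘ toℕ)) ≡ xorSum n (λ y → g y ∧ w y)
inner-tabulate {zero}  w g = refl
inner-tabulate {suc n} w g = cong (g 0 ∧ w 0 xor_) (inner-tabulate {n} (w ∘ suc) (g ∘ suc))

digitChange : ℕ → ℕ → Bool
digitChange a y = bit a (suc y) xor bit a y

-- digitChange a y holds exactly when 2^a divides y + 1, so ψ a X is the parity of the number of
-- multiples of 2^a in X (the index y of a Subset stands for the element y + 1).
ψ : ∀ {n} → ℕ → Subset n → Bool
ψ a = inner (digitChange a)

ψ-Δ : ∀ {n} a (X Y : Subset n) → ψ a (X Δ Y) ≡ ψ a X xor ψ a Y
ψ-Δ a = inner-Δ (digitChange a)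

xorSum-digitChange : ∀ n a → xorSum n (digitChange a) ≡ bit a n
xorSum-digitChange n a =
  trans (xorSum-telescope n (bit a)) (trans (cong (bit a n xor_) (bit-0 a)) (𝔹.xor-identityʳ (bit a n)))

ψ-∁ : ∀ {n} a (X : Subset n) → ψ a (∁ X) ≡ ψ a X xor bit a n
ψ-∁ {n} a X = trans (inner-∁ (digitChange a) X) (cong (ψ a X xor_) (xorSum-digitChange n a))

ψ-initial : ∀ {n} a {j} → j ≤ n → ψ a (tabulate {n} (λ x → toℕ x <ᵇ j)) ≡ bit a j
ψ-initial {n} a {j} j≤n = begin
  ψ a (tabulate {n} (λ x → toℕ x <ᵇ j))        ≡⟨ inner-tabulate {n} (digitChange a) (_<ᵇ j) ⟩
  xorSum n (λ y → (y <ᵇ j) ∧ digitChange a y) ≡⟨ xorSum-below (digitChange a) j≤n ⟩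
  xorSum j (digitChange a)                    ≡⟨ xorSum-digitChange j a ⟩
  bit a j                                     ∎
  where open ≡-Reasoning

≤ᵇ≡not<ᵇ : ∀ i y → (i ≤ᵇ y) ≡ not (y <ᵇ i)
≤ᵇ≡not<ᵇ zero          y       = refl
≤ᵇ≡not<ᵇ (suc i)       zero    = refl
≤ᵇ≡not<ᵇ (suc zero)    (suc y) = refl
≤ᵇ≡not<ᵇ (suc (suc i)) (suc y) = ≤ᵇ≡not<ᵇ (suc i) y

≤ᵇ-true : ∀ {m n} → m ≤ n → (m ≤ᵇ n) ≡ true
≤ᵇ-true m≤n = Equivalence.to 𝔹.T-≡ (ℕ.≤⇒≤ᵇ m≤n)

≤ᵇ-false : ∀ {m n} → n < m → (m ≤ᵇ n) ≡ false
≤ᵇ-false {m} {n} n<m with m ≤ᵇ n | ℕ.≤ᵇ-reflects-≤ m n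
... | false | _       = refl
... | true  | ofʸ m≤n = ⊥-elim (ℕ.<⇒≱ n<m m≤n)

⟨⟩-initial : ∀ {N j} → j ≤ N → ⟨_⟩ {N} j ≡ tabulate (λ x → toℕ x <ᵇ j)
⟨⟩-initial {N} {j} j≤N =
  Vec.tabulate-cong (λ x → cong (λ b → if b then toℕ x <ᵇ j else (j ∸ N) ≤ᵇ toℕ x) (≤ᵇ-true j≤N))

⟨⟩-final : ∀ {N j} → N < j → j ≤ N + N → ⟨_⟩ {N} j ≡ ∁ (⟨_⟩ {N} (j ∸ N))
⟨⟩-final {N} {j} N<j j≤2N = begin
  ⟨_⟩ {N} j
    ≡⟨ Vec.tabulate-cong (λ x → trans (cong (λ b → if b then toℕ x <ᵇ j else (j ∸ N) ≤ᵇ toℕ x) (≤ᵇ-false N<j))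
                                      (≤ᵇ≡not<ᵇ (j ∸ N) (toℕ x))) ⟩
  tabulate (not ∘ λ x → toℕ x <ᵇ j ∸ N)
    ≡⟨ Vec.tabulate-∘ not (λ x → toℕ x <ᵇ j ∸ N) ⟩
  ∁ (tabulate (λ x → toℕ x <ᵇ j ∸ N))
    ≡⟨ cong ∁ (⟨⟩-initial (ℕ.m≤n+o⇒m∸n≤o j N j≤2N)) ⟨
  ∁ (⟨_⟩ {N} (j ∸ N))
    ∎
  where open ≡-Reasoning

⟨N⟩≡∁⟨0⟩ : ∀ {N} → ⟨_⟩ {N} N ≡ ∁ (⟨_⟩ {N} 0)
⟨N⟩≡∁⟨0⟩ {N} = begin
  ⟨_⟩ {N} N                       ≡⟨ ⟨⟩-initial ℕ.≤-refl ⟩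
  tabulate {N} (λ x → toℕ x <ᵇ N) ≡⟨ Vec.tabulate-cong (λ x → Equivalence.to 𝔹.T-≡ (ℕ.<⇒<ᵇ (toℕ<n x))) ⟩
  tabulate {N} (λ _ → true)       ≡⟨ Vec.tabulate-∘ not (λ _ → false) ⟩
  ∁ (⟨_⟩ {N} 0)                   ∎
  where open ≡-Reasoning

ψ-⟨⟩ : ∀ K a {j} → j < 2 ^ K + 2 ^ K → ψ a (⟨_⟩ {2 ^ K} j) ≡ bit a j
ψ-⟨⟩ K a {j} j<2N with j ℕ.≤? 2 ^ K
... | yes j≤N = trans (cong (ψ a) (⟨⟩-initial j≤N)) (ψ-initial a j≤N)
... | no  j≰N = begin
  ψ a (⟨_⟩ {N} j)             ≡⟨ cong (ψ a) (⟨⟩-final N<j (ℕ.<⇒≤ j<2N)) ⟩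
  ψ a (∁ (⟨_⟩ {N} i))         ≡⟨ ψ-∁ a (⟨_⟩ {N} i) ⟩
  ψ a (⟨_⟩ {N} i) xor bit a N ≡⟨ cong (_xor bit a N) (trans (cong (ψ a) (⟨⟩-initial i≤N)) (ψ-initial a i≤N)) ⟩
  bit a i xor bit a N         ≡⟨ 𝔹.xor-comm (bit a i) (bit a N) ⟩
  bit a N xor bit a i         ≡⟨ bit-2^+ K a i<N ⟨
  bit a (N + i)               ≡⟨ cong (bit a) (ℕ.m+[n∸m]≡n (ℕ.<⇒≤ N<j)) ⟩
  bit a j                     ∎
  where
  open ≡-Reasoning
  N i : ℕ
  N = 2 ^ K
  i = j ∸ N
  N<j : N < j
  N<j = ℕ.≰⇒> j≰N
  i<N : i < N
  i<N = ℕ.+-cancelˡ-< N i N (subst (_< N + N) (sym (ℕ.m+[n∸m]≡n (ℕ.<⇒≤ N<j))) j<2N)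
  i≤N : i ≤ N
  i≤N = ℕ.<⇒≤ i<N

-- Invariance under H

≡ᵇ-true⇒≡ : ∀ {m n} → (m ≡ᵇ n) ≡ true → m ≡ n
≡ᵇ-true⇒≡ {m} {n} eq = ℕ.≡ᵇ⇒≡ m n (Equivalence.from 𝔹.T-≡ eq)

∨-disjoint : ∀ {p q} → p ≢ q → ∀ y → ((y ≡ᵇ p) ∨ (y ≡ᵇ q)) ≡ (y ≡ᵇ p) xor (y ≡ᵇ q)
∨-disjoint {p} {q} p≢q y with y ≡ᵇ p in y≡p | y ≡ᵇ q in y≡q
... | false | _     = refl
... | true  | false = refl
... | true  | true  = ⊥-elim (p≢q (trans (sym (≡ᵇ-true⇒≡ {y} y≡p)) (≡ᵇ-true⇒≡ {y} y≡q)))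

ψ-pair : ∀ {n} a {p q} → p ≢ q → p < n → q < n →
         ψ a (pair {n} (suc p) (suc q)) ≡ digitChange a p xor digitChange a q
ψ-pair {n} a {p} {q} p≢q p<n q<n = begin
  ψ a (pair {n} (suc p) (suc q))
    ≡⟨ inner-tabulate {n} d (λ y → (y ≡ᵇ p) ∨ (y ≡ᵇ q)) ⟩
  xorSum n (λ y → ((y ≡ᵇ p) ∨ (y ≡ᵇ q)) ∧ d y)
    ≡⟨ xorSum-cong n (λ y → trans (cong (_∧ d y) (∨-disjoint p≢q y))
                                  (𝔹.∧-distribʳ-xor (d y) (y ≡ᵇ p) (y ≡ᵇ q))) ⟩
  xorSum n (λ y → (y ≡ᵇ p) ∧ d y xor (y ≡ᵇ q) ∧ d y)
    ≡⟨ xorSum-xor n (λ y → (y ≡ᵇ p) ∧ d y) (λ y → (y ≡ᵇ q) ∧ d y) ⟩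
  xorSum n (λ y → (y ≡ᵇ p) ∧ d y) xor xorSum n (λ y → (y ≡ᵇ q) ∧ d y)
    ≡⟨ cong₂ _xor_ (xorSum-point d p<n) (xorSum-point d q<n) ⟩
  d p xor d q
    ∎
  where
  open ≡-Reasoning
  d : ℕ → Bool
  d = digitChange a

digitChange-2^+ : ∀ k a {y} → suc y < 2 ^ k → digitChange a (2 ^ k + y) ≡ digitChange a y
digitChange-2^+ k a {y} 1+y<P = begin
  bit a (suc (P + y)) xor bit a (P + y)
    ≡⟨ cong (λ s → bit a s xor bit a (P + y)) (ℕ.+-suc P y) ⟨
  bit a (P + suc y) xor bit a (P + y)
    ≡⟨ cong₂ _xor_ (bit-2^+ k a 1+y<P) (bit-2^+ k a (ℕ.<-trans (ℕ.n<1+n y) 1+y<P)) ⟩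
  (bit a P xor bit a (suc y)) xor (bit a P xor bit a y)
    ≡⟨ cancel (bit a P) (bit a (suc y)) (bit a y) ⟩
  bit a (suc y) xor bit a y
    ∎
  where
  open ≡-Reasoning
  P : ℕ
  P = 2 ^ k
  cancel : ∀ p x y → (p xor x) xor (p xor y) ≡ x xor y
  cancel = solve 3 (λ p x y → (p :+ x) :+ (p :+ y) := x :+ y) refl
    where open xor-∧-Solver

≤∸1⇒< : ∀ {m n} → 0 < n → m ≤ n ∸ 1 → m < n
≤∸1⇒< {n = suc n} _ m≤n = s≤s m≤n

ψ-generator : ∀ m a {X : Subset (2 ^ (m ∸ 1))} → Gen m X → ψ a X ≡ false
ψ-generator m a (gen (suc (suc k)) (suc j) (s≤s (s≤s z≤n)) i≤m∸1 (s≤s z≤n) 1+j≤P∸1) = begin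
  ψ a (pair {N} (suc j) (P + suc j))        ≡⟨ cong (λ q → ψ a (pair {N} (suc j) q)) (ℕ.+-suc P j) ⟩
  ψ a (pair {N} (suc j) (suc (P + j)))      ≡⟨ ψ-pair a j≢P+j j<N P+j<N ⟩
  digitChange a j xor digitChange a (P + j) ≡⟨ cong (digitChange a j xor_) (digitChange-2^+ (suc k) a 1+j<P) ⟩
  digitChange a j xor digitChange a j       ≡⟨ 𝔹.xor-same (digitChange a j) ⟩
  false                                     ∎
  where
  open ≡-Reasoning
  N P : ℕ
  N = 2 ^ (m ∸ 1)
  P = 2 ^ suc k
  1+j<P : suc j < P
  1+j<P = ≤∸1⇒< (ℕ.m^n>0 2 (suc k)) 1+j≤P∸1
  P+j<N : P + j < N
  P+j<N = ℕ.<-≤-trans (ℕ.+-monoʳ-< P (ℕ.<-trans (ℕ.n<1+n j) 1+j<P))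
                      (subst (_≤ N) (cong (P +_) (ℕ.+-identityʳ P)) (ℕ.^-monoʳ-≤ 2 i≤m∸1))
  j<N : j < N
  j<N = ℕ.≤-<-trans (ℕ.m≤n+m j P) P+j<N
  j≢P+j : j ≢ P + j
  j≢P+j = ℕ.<⇒≢ (ℕ.m<n+m j (ℕ.m^n>0 2 (suc k)))

ψ-H : ∀ m a {X : Subset (2 ^ (m ∸ 1))} → InH m X → ψ a X ≡ false
ψ-H m a h-zero                    = inner-⊥ (2 ^ (m ∸ 1)) (digitChange a)
ψ-H m a (h-step {X} {g} X∈H g∈G) = trans (ψ-Δ a X g) (cong₂ _xor_ (ψ-H m a X∈H) (ψ-generator m a g∈G))

Δ-cancelʳ : ∀ {n} (X Y Z : Subset n) → X Δ Z ≡ Y Δ Z → X ≡ Y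
Δ-cancelʳ []      []      []      _  = refl
Δ-cancelʳ (x ∷ X) (y ∷ Y) (z ∷ Z) eq =
  cong₂ _∷_ (xor-injectiveˡ (Vec.∷-injectiveˡ eq) refl) (Δ-cancelʳ X Y Z (Vec.∷-injectiveʳ eq))

Δ-cancelˡ : ∀ {n} (Z X Y : Subset n) → Z Δ X ≡ Z Δ Y → X ≡ Y
Δ-cancelˡ Z X Y eq =
  Δ-cancelʳ X Y Z (trans (Vec.zipWith-comm 𝔹.xor-comm X Z) (trans eq (Vec.zipWith-comm 𝔹.xor-comm Z Y)))

Δ-self : ∀ {n} (X : Subset n) → X Δ X ≡ replicate n false
Δ-self []      = refl
Δ-self (x ∷ X) = cong₂ _∷_ (𝔹.xor-same x) (Δ-self X)

Δ-Δ-shared : ∀ {n} (Z X Y : Subset n) → (Z Δ X) Δ (Z Δ Y) ≡ X Δ Y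
Δ-Δ-shared []      []      []      = refl
Δ-Δ-shared (z ∷ Z) (x ∷ X) (y ∷ Y) = cong₂ _∷_ (cancel z x y) (Δ-Δ-shared Z X Y)
  where
  cancel : ∀ z x y → (z xor x) xor (z xor y) ≡ x xor y
  cancel = solve 3 (λ z x y → (z :+ x) :+ (z :+ y) := x :+ y) refl
    where open xor-∧-Solver

∁-Δ-∁ : ∀ {n} (X Y : Subset n) → ∁ X Δ ∁ Y ≡ X Δ Y
∁-Δ-∁ []      []      = refl
∁-Δ-∁ (x ∷ X) (y ∷ Y) = cong₂ _∷_ (𝔹.xor-annihilates-not x y) (∁-Δ-∁ X Y)

Δ-tabulate : ∀ {n} (f g : Fin n → Bool) → tabulate f Δ tabulate g ≡ tabulate (λ x → f x xor g x)
Δ-tabulate {zero}  f g = refl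
Δ-tabulate {suc n} f g = cong ((f Fin.zero xor g Fin.zero) ∷_) (Δ-tabulate (f ∘ Fin.suc) (g ∘ Fin.suc))

ιΔθ : ∀ {N} (L R : Subset N) → ι L Δ θ R ≡ L ++ R
ιΔθ {N} L R = trans (Vec.zipWith-++ _xor_ L (replicate N false) (replicate N false) R)
                    (cong₂ _++_ (Vec.zipWith-identityʳ 𝔹.xor-identityʳ L) (Vec.zipWith-identityˡ 𝔹.xor-identityˡ R))

ιΔθ-injective : ∀ {N} {L R L′ R′ : Subset N} → ι L Δ θ R ≡ ι L′ Δ θ R′ → L ≡ L′ × R ≡ R′
ιΔθ-injective {L = L} {R} {L′} {R′} eq = Vec.++-injective L L′ (trans (sym (ιΔθ L R)) (trans eq (ιΔθ L′ R′)))

∣++∣ : ∀ {m n} (X : Subset m) (Y : Subset n) → ∣ X ++ Y ∣ ≡ ∣ X ∣ + ∣ Y ∣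
∣++∣ []          Y = refl
∣++∣ (true ∷ X)  Y = cong suc (∣++∣ X Y)
∣++∣ (false ∷ X) Y = ∣++∣ X Y

∣tabulate-false∣ : ∀ n → ∣ tabulate {n} (λ _ → false) ∣ ≡ 0
∣tabulate-false∣ zero    = refl
∣tabulate-false∣ (suc n) = ∣tabulate-false∣ n

∣tabulate-≡ᵇ∣ : ∀ {n q} → q < n → ∣ tabulate {n} (λ x → toℕ x ≡ᵇ q) ∣ ≡ 1
∣tabulate-≡ᵇ∣ {suc n} {zero}  _         = cong suc (∣tabulate-false∣ n)
∣tabulate-≡ᵇ∣ {suc n} {suc q} (s≤s q<n) = ∣tabulate-≡ᵇ∣ q<n

<ᵇ-xor-<ᵇ : ∀ y k → (y <ᵇ k) xor (y <ᵇ suc k) ≡ (y ≡ᵇ k)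
<ᵇ-xor-<ᵇ zero    zero    = refl
<ᵇ-xor-<ᵇ zero    (suc k) = refl
<ᵇ-xor-<ᵇ (suc y) zero    = refl
<ᵇ-xor-<ᵇ (suc y) (suc k) = <ᵇ-xor-<ᵇ y k

∣⟨k⟩Δ⟨1+k⟩∣-below : ∀ {N k} → k < N → ∣ ⟨_⟩ {N} k Δ ⟨ suc k ⟩ ∣ ≡ 1
∣⟨k⟩Δ⟨1+k⟩∣-below {N} {k} k<N = begin
  ∣ ⟨_⟩ {N} k Δ ⟨ suc k ⟩ ∣
    ≡⟨ cong ∣_∣ (cong₂ _Δ_ (⟨⟩-initial (ℕ.<⇒≤ k<N)) (⟨⟩-initial k<N)) ⟩
  ∣ tabulate {N} (λ x → toℕ x <ᵇ k) Δ tabulate (λ x → toℕ x <ᵇ suc k) ∣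
    ≡⟨ cong (∣_∣ {N}) (trans (Δ-tabulate (λ x → toℕ x <ᵇ k) (λ x → toℕ x <ᵇ suc k))
                             (Vec.tabulate-cong (λ x → <ᵇ-xor-<ᵇ (toℕ x) k))) ⟩
  ∣ tabulate {N} (λ x → toℕ x ≡ᵇ k) ∣
    ≡⟨ ∣tabulate-≡ᵇ∣ k<N ⟩
  1 ∎
  where open ≡-Reasoning

∣⟨k⟩Δ⟨1+k⟩∣ : ∀ {N k} → 0 < N → k ≤ N → ∣ ⟨_⟩ {N} k Δ ⟨ suc k ⟩ ∣ ≡ 1
∣⟨k⟩Δ⟨1+k⟩∣ {N} {k} 0<N k≤N with ℕ.m≤n⇒m<n∨m≡n k≤N
... | inj₁ k<N  = ∣⟨k⟩Δ⟨1+k⟩∣-below k<N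
... | inj₂ refl = begin
  ∣ ⟨_⟩ {N} N Δ ⟨ suc N ⟩ ∣
    ≡⟨ cong ∣_∣ (cong₂ _Δ_ ⟨N⟩≡∁⟨0⟩ (⟨⟩-final (ℕ.n<1+n N) (ℕ.+-monoˡ-≤ N 0<N))) ⟩
  ∣ ∁ (⟨_⟩ {N} 0) Δ ∁ ⟨ suc N ∸ N ⟩ ∣
    ≡⟨ cong ∣_∣ (∁-Δ-∁ (⟨_⟩ {N} 0) ⟨ suc N ∸ N ⟩) ⟩
  ∣ ⟨_⟩ {N} 0 Δ ⟨ suc N ∸ N ⟩ ∣
    ≡⟨ cong (λ j → ∣ ⟨_⟩ {N} 0 Δ ⟨ j ⟩ ∣) (ℕ.m+n∸n≡m 1 N) ⟩
  ∣ ⟨_⟩ {N} 0 Δ ⟨ 1 ⟩ ∣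
    ≡⟨ ∣⟨k⟩Δ⟨1+k⟩∣-below 0<N ⟩
  1 ∎
  where open ≡-Reasoning

complementIf : ∀ {n} → Bool → Subset n → Subset n
complementIf false X = X
complementIf true  X = ∁ X

complementIf-Δ : ∀ {n} f (X Y : Subset n) → complementIf f X Δ complementIf f Y ≡ X Δ Y
complementIf-Δ false X Y = refl
complementIf-Δ true  X Y = ∁-Δ-∁ X Y

ψ-complementIf : ∀ {n} a f (X : Subset n) → ψ a (complementIf f X) ≡ ψ a X xor (f ∧ bit a n)
ψ-complementIf a false X = sym (𝔹.xor-identityʳ (ψ a X))
ψ-complementIf a true  X = ψ-∁ a X

injective-endpoints⇒isMatching :
  ∀ {k} {P : Set} (Valid : P → Set) (end : P → Bool → Subset k) →
  (∀ {π π′ e e′} → Valid π → Valid π′ → end π e ≡ end π′ e′ → π ≡ π′ × e ≡ e′) →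
  (∀ {π} → Valid π → Adjacent (end π false) (end π true)) →
  {E : Subset k → Subset k → Set} →
  (∀ {u v} → E u v → Σ P λ π → Valid π × u ≡ end π false × v ≡ end π true) →
  IsMatching E
injective-endpoints⇒isMatching {P = P} Valid end end-injective end-adjacent {E} endpoints = adjacent , disjoint
  where
  adjacent : ∀ u v → E u v → Adjacent u v
  adjacent u v uv with endpoints uv
  ... | π , π-valid , refl , refl = end-adjacent π-valid

  false≢true : false ≢ true
  false≢true ()

  same-edge : ∀ {π π′ : P} {e e′ : Bool} → π ≡ π′ × e ≡ e′ →
              (end π false ≡ end π′ false × end π true ≡ end π′ true) ⊎
              (end π false ≡ end π′ true × end π true ≡ end π′ false)
  same-edge (refl , _) = inj₁ (refl , refl)

  disjoint : ∀ u v u′ v′ → E u v → E u′ v′ →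
             (u ≡ u′ ⊎ u ≡ v′ ⊎ v ≡ u′ ⊎ v ≡ v′) → (u ≡ u′ × v ≡ v′) ⊎ (u ≡ v′ × v ≡ u′)
  disjoint u v u′ v′ uv u′v′ with endpoints uv | endpoints u′v′
  ... | π , π-valid , refl , refl | π′ , π′-valid , refl , refl = λ where
    (inj₁ u≡u′)               → same-edge (end-injective π-valid π′-valid u≡u′)
    (inj₂ (inj₁ u≡v′))        → ⊥-elim (false≢true (proj₂ (end-injective π-valid π′-valid u≡v′)))
    (inj₂ (inj₂ (inj₁ v≡u′))) → ⊥-elim (false≢true (sym (proj₂ (end-injective π-valid π′-valid v≡u′))))
    (inj₂ (inj₂ (inj₂ v≡v′))) → same-edge (end-injective π-valid π′-valid v≡v′)

-- The edges of M

module Edges (b : ℕ) where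

  m : ℕ
  m = suc (suc b)

  N : ℕ
  N = 2 ^ suc b

  leftAt : Bool → ℕ → ℕ → Subset N → Subset N
  leftAt f c k A = A Δ ⟨ c ⟩ Δ complementIf f ⟨ k ⟩

  rightAt : Bool → ℕ → ℕ → Subset N → Subset N
  rightAt f c s B = complementIf (not f) ⟨ s ⟩ Δ ⟨ c ⟩ Δ B

  -- With c = 2i − 2, s = r − 1 and k = N + 2i − 1 − r or N + 2i − r this is an endpoint of an edge
  -- of the first (f = true) or of the second (f = false) form.
  vertexAt : Bool → ℕ → ℕ → ℕ → Subset N → Subset N → Subset (N + N)
  vertexAt f c k s A B = ι (leftAt f c k A) Δ θ (rightAt f c s B)

  -- i = p + 1 and r = 2p + 1 + t
  record Parameters : Set where
    constructor params
    field
      form : Bool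
      p t  : ℕ
      A B  : Subset N

  vertex : Parameters → Bool → Subset (N + N)
  vertex (params f p t A B) e = vertexAt f (2 * p) (N ∸ t + boolToℕ e) (2 * p + t) A B

  record Valid (π : Parameters) : Set where
    constructor valid
    field
      2p<N : 2 * Parameters.p π < N
      t<N  : Parameters.t π < N
      A∈H  : InH m (Parameters.A π)
      B∈H  : InH m (Parameters.B π)

  1<N : 1 < N
  1<N = ℕ.*-monoʳ-≤ 2 (ℕ.m^n>0 2 b)

  <N⇒<2N : ∀ {c} → c < N → c < N + N
  <N⇒<2N c<N = ℕ.<-≤-trans c<N (ℕ.m≤m+n N N)

  ∸+boolToℕ<2N : ∀ t e → N ∸ t + boolToℕ e < N + N
  ∸+boolToℕ<2N t e = ℕ.+-mono-≤-< (ℕ.m∸n≤m N t) (ℕ.≤-<-trans (boolToℕ≤1 e) 1<N)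

  ψ-leftAt : ∀ a f {c k A} → InH m A → c < N + N → k < N + N →
             ψ a (leftAt f c k A) ≡ bit a c xor bit a k xor (f ∧ bit a N)
  ψ-leftAt a f {c} {k} {A} A∈H c<2N k<2N = begin
    ψ a (A Δ ⟨ c ⟩ Δ complementIf f ⟨ k ⟩)
      ≡⟨ ψ-Δ a (A Δ ⟨ c ⟩) (complementIf f ⟨ k ⟩) ⟩
    ψ a (A Δ ⟨ c ⟩) xor ψ a (complementIf f (⟨_⟩ {N} k))
      ≡⟨ cong₂ _xor_ (trans (ψ-Δ a A ⟨ c ⟩) (cong₂ _xor_ (ψ-H m a A∈H) (ψ-⟨⟩ (suc b) a c<2N)))
                     (trans (ψ-complementIf a f ⟨ k ⟩) (cong (_xor (f ∧ bit a N)) (ψ-⟨⟩ (suc b) a k<2N))) ⟩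
    bit a c xor bit a k xor (f ∧ bit a N)
      ∎
    where open ≡-Reasoning

  ψ-rightAt : ∀ a f {c s B} → InH m B → c < N + N → s < N + N →
              ψ a (rightAt f c s B) ≡ (bit a s xor (not f ∧ bit a N)) xor bit a c
  ψ-rightAt a f {c} {s} {B} B∈H c<2N s<2N = begin
    ψ a (complementIf (not f) ⟨ s ⟩ Δ ⟨ c ⟩ Δ B)
      ≡⟨ ψ-Δ a (complementIf (not f) ⟨ s ⟩ Δ ⟨ c ⟩) B ⟩
    ψ a (complementIf (not f) ⟨ s ⟩ Δ ⟨ c ⟩) xor ψ a B
      ≡⟨ cong₂ _xor_ (trans (ψ-Δ a (complementIf (not f) ⟨ s ⟩) ⟨ c ⟩)
                            (cong₂ _xor_ (trans (ψ-complementIf a (not f) ⟨ s ⟩)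
                                                (cong (_xor (not f ∧ bit a N)) (ψ-⟨⟩ (suc b) a s<2N)))
                                         (ψ-⟨⟩ (suc b) a c<2N)))
                     (ψ-H m a B∈H) ⟩
    ((bit a s xor (not f ∧ bit a N)) xor bit a c) xor false
      ≡⟨ 𝔹.xor-identityʳ _ ⟩
    (bit a s xor (not f ∧ bit a N)) xor bit a c
      ∎
    where open ≡-Reasoning

  vertex-numbers : ∀ {f p t A B f′ p′ t′ A′ B′ e e′} →
                   Valid (params f p t A B) → Valid (params f′ p′ t′ A′ B′) →
                   vertex (params f p t A B) e ≡ vertex (params f′ p′ t′ A′ B′) e′ →
                   f ≡ f′ × p ≡ p′ × t ≡ t′ × e ≡ e′
  vertex-numbers {f} {p} {t} {A} {B} {f′} {p′} {t′} {A′} {B′} {e} {e′}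
                 (valid 2p<N t<N A∈H B∈H) (valid 2p′<N t′<N A′∈H B′∈H) eq =
    let 2p≡2p′ , t≡t′ , e≡e′ , f≡f′ = decode (odd-2* p) (odd-2* p′) 2p<N 2p′<N t<N t′<N ψ-left≡ ψ-right≡
    in  f≡f′ , ℕ.*-cancelˡ-≡ p p′ 2 2p≡2p′ , t≡t′ , e≡e′
    where
    open Decoding b using (decode)
    halves : leftAt f (2 * p) (N ∸ t + boolToℕ e) A ≡ leftAt f′ (2 * p′) (N ∸ t′ + boolToℕ e′) A′ ×
             rightAt f (2 * p) (2 * p + t) B ≡ rightAt f′ (2 * p′) (2 * p′ + t′) B′
    halves = ιΔθ-injective eq
    ψ-left≡ : ∀ a → bit a (2 * p) xor bit a (N ∸ t + boolToℕ e) xor (f ∧ bit a N) ≡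
                    bit a (2 * p′) xor bit a (N ∸ t′ + boolToℕ e′) xor (f′ ∧ bit a N)
    ψ-left≡ a = trans (sym (ψ-leftAt a f A∈H (<N⇒<2N 2p<N) (∸+boolToℕ<2N t e)))
                (trans (cong (ψ a) (proj₁ halves))
                       (ψ-leftAt a f′ A′∈H (<N⇒<2N 2p′<N) (∸+boolToℕ<2N t′ e′)))
    ψ-right≡ : ∀ a → (bit a (2 * p + t) xor (not f ∧ bit a N)) xor bit a (2 * p) ≡
                     (bit a (2 * p′ + t′) xor (not f′ ∧ bit a N)) xor bit a (2 * p′)
    ψ-right≡ a = trans (sym (ψ-rightAt a f B∈H (<N⇒<2N 2p<N) (ℕ.+-mono-< 2p<N t<N)))
                 (trans (cong (ψ a) (proj₂ halves))
                        (ψ-rightAt a f′ B′∈H (<N⇒<2N 2p′<N) (ℕ.+-mono-< 2p′<N t′<N)))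

  vertex-sets : ∀ {f p t A B A′ B′ e} → vertex (params f p t A B) e ≡ vertex (params f p t A′ B′) e →
                A ≡ A′ × B ≡ B′
  vertex-sets {f} {p} {t} {A} {B} {A′} {B′} {e} eq =
    Δ-cancelʳ A A′ ⟨ 2 * p ⟩
      (Δ-cancelʳ (A Δ ⟨ 2 * p ⟩) (A′ Δ ⟨ 2 * p ⟩) (complementIf f ⟨ N ∸ t + boolToℕ e ⟩) (proj₁ halves)) ,
    Δ-cancelˡ (complementIf (not f) ⟨ 2 * p + t ⟩ Δ ⟨ 2 * p ⟩) B B′ (proj₂ halves)
    where
    halves : leftAt f (2 * p) (N ∸ t + boolToℕ e) A ≡ leftAt f (2 * p) (N ∸ t + boolToℕ e) A′ ×
             rightAt f (2 * p) (2 * p + t) B ≡ rightAt f (2 * p) (2 * p + t) B′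
    halves = ιΔθ-injective eq

  same-numbers⇒same-vertex-parameters :
    ∀ {f p t A B f′ p′ t′ A′ B′ e e′} → f ≡ f′ × p ≡ p′ × t ≡ t′ × e ≡ e′ →
    vertex (params f p t A B) e ≡ vertex (params f′ p′ t′ A′ B′) e′ →
    params f p t A B ≡ params f′ p′ t′ A′ B′ × e ≡ e′
  same-numbers⇒same-vertex-parameters {f} {p} {t} {A} {B} {A′ = A′} {B′} {e} (refl , refl , refl , refl) eq =
    let A≡A′ , B≡B′ = vertex-sets {f} {p} {t} {A} {B} {A′} {B′} {e} eq
    in  cong₂ (params f p t) A≡A′ B≡B′ , refl

  vertex-injective : ∀ {π π′ e e′} → Valid π → Valid π′ → vertex π e ≡ vertex π′ e′ → π ≡ π′ × e ≡ e′
  vertex-injective {params f p t A B} {params f′ p′ t′ A′ B′} {e} {e′} π-valid π′-valid eq =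
    same-numbers⇒same-vertex-parameters {f} {p} {t} {A} {B} {f′} {p′} {t′} {A′} {B′} {e} {e′}
      (vertex-numbers π-valid π′-valid eq) eq

  vertex-adjacent : ∀ {π} → Valid π → Adjacent (vertex π false) (vertex π true)
  vertex-adjacent {params f p t A B} (valid _ t<N _ _) = begin
    ∣ ι L₀ Δ θ R Δ (ι L₁ Δ θ R) ∣
      ≡⟨ cong ∣_∣ (cong₂ _Δ_ (ιΔθ L₀ R) (ιΔθ L₁ R)) ⟩
    ∣ (L₀ ++ R) Δ (L₁ ++ R) ∣
      ≡⟨ cong ∣_∣ (Vec.zipWith-++ _xor_ L₀ R L₁ R) ⟩
    ∣ (L₀ Δ L₁) ++ (R Δ R) ∣
      ≡⟨ ∣++∣ (L₀ Δ L₁) (R Δ R) ⟩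
    ∣ L₀ Δ L₁ ∣ + ∣ R Δ R ∣
      ≡⟨ cong₂ _+_ (cong ∣_∣ L₀ΔL₁) (trans (cong ∣_∣ (Δ-self R)) (∣⊥∣≡0 N)) ⟩
    ∣ ⟨_⟩ {N} (N ∸ t + 0) Δ ⟨ N ∸ t + 1 ⟩ ∣ + 0
      ≡⟨ ℕ.+-identityʳ _ ⟩
    ∣ ⟨_⟩ {N} (N ∸ t + 0) Δ ⟨ N ∸ t + 1 ⟩ ∣
      ≡⟨ cong₂ (λ j j′ → ∣ ⟨_⟩ {N} j Δ ⟨ j′ ⟩ ∣) (ℕ.+-identityʳ (N ∸ t)) (ℕ.+-comm (N ∸ t) 1) ⟩
    ∣ ⟨_⟩ {N} (N ∸ t) Δ ⟨ suc (N ∸ t) ⟩ ∣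
      ≡⟨ ∣⟨k⟩Δ⟨1+k⟩∣ (ℕ.<-trans (s≤s z≤n) 1<N) (ℕ.m∸n≤m N t) ⟩
    1
      ∎
    where
    open ≡-Reasoning
    L₀ L₁ R : Subset N
    L₀ = leftAt f (2 * p) (N ∸ t + 0) A
    L₁ = leftAt f (2 * p) (N ∸ t + 1) A
    R = rightAt f (2 * p) (2 * p + t) B
    L₀ΔL₁ : L₀ Δ L₁ ≡ ⟨ N ∸ t + 0 ⟩ Δ ⟨ N ∸ t + 1 ⟩
    L₀ΔL₁ = trans (Δ-Δ-shared (A Δ ⟨ 2 * p ⟩) (complementIf f ⟨ N ∸ t + 0 ⟩) (complementIf f ⟨ N ∸ t + 1 ⟩))
                  (complementIf-Δ f ⟨ N ∸ t + 0 ⟩ ⟨ N ∸ t + 1 ⟩)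

  N+2[1+p] : ∀ p → N + 2 * suc p ≡ suc (suc (2 * p + N))
  N+2[1+p] p = trans (cong (N +_) (ℕ.*-suc 2 p)) (ℕ.+-comm N (2 + 2 * p))

  offset : ∀ {p r} → 2 * suc p ∸ 1 ≤ r → r ≤ N + 2 * suc p ∸ 2 → Σ ℕ λ t → t < N × r ≡ suc (2 * p + t)
  offset {p} {r} r≥ r≤ = r ∸ suc (2 * p) , t<N , sym (ℕ.m+[n∸m]≡n 1+2p≤r)
    where
    1+2p≤r : suc (2 * p) ≤ r
    1+2p≤r = subst (_≤ r) (cong (_∸ 1) (ℕ.*-suc 2 p)) r≥
    r≤2p+N : r ≤ 2 * p + N
    r≤2p+N = subst (r ≤_) (trans (cong (λ n → N + n ∸ 2) (ℕ.*-suc 2 p))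
                                 (trans (ℕ.+-∸-assoc N (ℕ.m≤m+n 2 (2 * p))) (ℕ.+-comm N (2 * p)))) r≤
    t<N : r ∸ suc (2 * p) < N
    t<N = ℕ.+-cancelˡ-< (2 * p) (r ∸ suc (2 * p)) N (subst (_≤ 2 * p + N) (sym (ℕ.m+[n∸m]≡n 1+2p≤r)) r≤2p+N)

  reparametrise : ∀ f {i r A B} → 1 ≤ i → i ≤ 2 ^ b → InH m A → InH m B →
                  2 * i ∸ 1 ≤ r → r ≤ N + 2 * i ∸ 2 →
                  Σ Parameters λ π → Valid π ×
                    vertexAt f (2 * i ∸ 2) (N + 2 * i ∸ 1 ∸ r) (r ∸ 1) A B ≡ vertex π false ×
                    vertexAt f (2 * i ∸ 2) (N + 2 * i ∸ r) (r ∸ 1) A B ≡ vertex π true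
  reparametrise f {suc p} {r} {A} {B} _ 1+p≤2^b A∈H B∈H r≥ r≤ with offset r≥ r≤
  ... | t , t<N , refl =
    params f p t A B , valid 2p<N t<N A∈H B∈H ,
    cong₂ (λ c k → vertexAt f c k (2 * p + t) A B) c≡ k₀≡ ,
    cong₂ (λ c k → vertexAt f c k (2 * p + t) A B) c≡ k₁≡
    where
    2p<N : 2 * p < N
    2p<N = ℕ.≤-trans (ℕ.n≤1+n (suc (2 * p))) (subst (_≤ N) (ℕ.*-suc 2 p) (ℕ.*-monoʳ-≤ 2 1+p≤2^b))
    c≡ : 2 * suc p ∸ 2 ≡ 2 * p
    c≡ = cong (_∸ 2) (ℕ.*-suc 2 p)
    k₀≡ : N + 2 * suc p ∸ 1 ∸ suc (2 * p + t) ≡ N ∸ t + 0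
    k₀≡ = begin
      N + 2 * suc p ∸ 1 ∸ suc (2 * p + t) ≡⟨ cong (λ n → n ∸ 1 ∸ suc (2 * p + t)) (N+2[1+p] p) ⟩
      (2 * p + N) ∸ (2 * p + t)           ≡⟨ ℕ.[m+n]∸[m+o]≡n∸o (2 * p) N t ⟩
      N ∸ t                               ≡⟨ ℕ.+-identityʳ (N ∸ t) ⟨
      N ∸ t + 0                           ∎
      where open ≡-Reasoning
    k₁≡ : N + 2 * suc p ∸ suc (2 * p + t) ≡ N ∸ t + 1
    k₁≡ = begin
      N + 2 * suc p ∸ suc (2 * p + t)     ≡⟨ cong (_∸ suc (2 * p + t)) (N+2[1+p] p) ⟩
      suc (2 * p + N) ∸ (2 * p + t)       ≡⟨ ℕ.+-∸-assoc 1 (ℕ.+-monoʳ-≤ (2 * p) (ℕ.<⇒≤ t<N)) ⟩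
      suc ((2 * p + N) ∸ (2 * p + t))     ≡⟨ cong suc (ℕ.[m+n]∸[m+o]≡n∸o (2 * p) N t) ⟩
      suc (N ∸ t)                         ≡⟨ ℕ.+-comm 1 (N ∸ t) ⟩
      N ∸ t + 1                           ∎
      where open ≡-Reasoning

  edge-endpoints : ∀ {u v} → InM m u v → Σ Parameters λ π → Valid π × u ≡ vertex π false × v ≡ vertex π true
  edge-endpoints (form₁ i r 1≤i i≤ A∈H B∈H r≥ r≤) = reparametrise true  1≤i i≤ A∈H B∈H r≥ r≤
  edge-endpoints (form₂ i r 1≤i i≤ A∈H B∈H r≥ r≤) = reparametrise false 1≤i i≤ A∈H B∈H r≥ r≤

lemma5p3 : ∀ (m : ℕ) → 2 ≤ m → IsMatching (InM m)
lemma5p3 (suc (suc b)) (s≤s (s≤s z≤n)) =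
  injective-endpoints⇒isMatching Valid vertex vertex-injective vertex-adjacent edge-endpoints
  where open Edges b
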